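{- For every context $\Gamma$ with $\Gamma\vdash$ derivable in $\mathsf{CaTT}$, the judgment $S(\Downarrow\Gamma)\vdash\rho_\Gamma:\Gamma$ is derivable in $\mathsf{CaTT}$.
   Context: Type-theoretic conventions. Raw contexts are finite lists $(x_1:A_1,\dots,x_n:A_n)$ of distinct variables with types; raw substitutions are lists $\langle x_1\mapsto t_1,\dots,x_n\mapsto t_n\rangle$; judgments $\Gamma\vdash$, $\Gamma\vdash A$, $\Gamma\vdash t:A$, $\Delta\vdash\sigma:\Gamma$. Common rules: $\varnothing\vdash$; from $\Gamma\vdash A$ with $x$ fresh infer $(\Gamma,x:A)\vdash$; from $\Gamma\vdash$ and $(x:A)\in\Gamma$ infer $\Gamma\vdash x:A$; from $\Delta\vdash$ infer $\Delta\vdash\langle\rangle:\varnothing$; from $\Delta\vdash\sigma:\Gamma$, $(\Gamma,x:A)\vdash$, $\Delta\vdash t:A[\sigma]$ infer $\Delta\vdash\langle\sigma,x\mapsto t\rangle:(\Gamma,x:A)$. Substitution on variables: $x[\langle\rangle]=x$, $x[\langle\sigma,y\mapsto t\rangle]=t$ if $x=y$ else $x[\sigma]$; composition $\langle\rangle\circ\delta=\langle\rangle$, $\langle\sigma,x\mapsto t\rangle\circ\delta=\langle\sigma\circ\delta,x\mapsto t[\delta]\rangle$. The theory $\mathsf{CaTT}$. Types: $\star$ and $\mathrm{Hom}_A\,t\,u$; terms: variables and $\mathrm{op}_{\Theta,A}[\sigma]$, $\mathrm{coh}_{\Theta,A}[\sigma]$. $\star[\sigma]=\star$, $(\mathrm{Hom}_At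 u)[\sigma]=\mathrm{Hom}_{A[\sigma]}t[\sigma]u[\sigma]$, $\mathrm{op}_{\Theta,A}[\tau][\sigma]=\mathrm{op}_{\Theta,A}[\tau\circ\sigma]$ (same for coh). $\mathrm{Var}(x)=\{x\}$, $\mathrm{Var}(\star)=\emptyset$, $\mathrm{Var}(\mathrm{Hom}_Atu)=\mathrm{Var}(A)\cup\mathrm{Var}(t)\cup\mathrm{Var}(u)$, $\mathrm{Var}$ of $\mathrm{op}/\mathrm{coh}_{\Theta,A}[\sigma]$ is the union of $\mathrm{Var}$ of the terms of $\sigma$; $\mathrm{Var}$ of a context = its declared variables. Rules: $\Gamma\vdash$ gives $\Gamma\vdash\star$; $\Gamma\vdash t:A$, $\Gamma\vdash u:A$ give $\Gamma\vdash\mathrm{Hom}_Atu$. $\dim\star=0$, $\dim\mathrm{Hom}_Atu=\dim A+1$, $\dim$ of a context = max dimension of its types. Ps-contexts: judgments generated by $(x:\star)\vdash_{ps}x:\star$; $\Gamma\vdash_{ps}f:\mathrm{Hom}_Axy\Rightarrow\Gamma\vdash_{ps}y:A$; $\Gamma\vdash_{ps}x:A\Rightarrow(\Gamma,y:A,f:\mathrm{Hom}_Axy)\vdash_{ps}f:\mathrm{Hom}_Axy$; $\Gamma\vdash_{ps}x:\star\Rightarrow\Gamma\vdash_{ps}$. Sources/targets: $\partial^\pm_i(x:\star)=(x:\star)$; $\partial^-_i(\Gamma,y:A,f:\mathrm{Hom}_Axy)=\partial^-_i\Gamma$ if $\dim A\ge i$, else $(\partial^-_i\Gamma,y:A,f:\mathrm{Hom}_Axy)$;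 $\partial^+_i(\Gamma,y:A,f:\mathrm{Hom}_Axy)=\partial^+_i\Gamma$ if $\dim A>i$, $(\mathrm{drop}(\partial^+_i\Gamma),y:A)$ if $\dim A=i$ (drop removes the last variable), else $(\partial^+_i\Gamma,y:A,f:\mathrm{Hom}_Axy)$; $\partial^\pm\Gamma=\partial^\pm_{\dim\Gamma-1}\Gamma$. $\Gamma\vdash_{op}\mathrm{Hom}_Atu$ means $\Gamma\vdash_{ps}$, $\partial^-\Gamma\vdash t:A$, $\partial^+\Gamma\vdash u:A$, $\mathrm{Var}(t)\cup\mathrm{Var}(A)=\mathrm{Var}(\partial^-\Gamma)$, $\mathrm{Var}(u)\cup\mathrm{Var}(A)=\mathrm{Var}(\partial^+\Gamma)$. $\Gamma\vdash_{eq}\mathrm{Hom}_Atu$ means $\Gamma\vdash_{ps}$, $\Gamma\vdash t:A$, $\Gamma\vdash u:A$, $\mathrm{Var}(t)\cup\mathrm{Var}(A)=\mathrm{Var}(u)\cup\mathrm{Var}(A)=\mathrm{Var}(\Gamma)$. Term rules: $\Theta\vdash_{op}A$ and $\Delta\vdash\sigma:\Theta$ give $\Delta\vdash\mathrm{op}_{\Theta,A}[\sigma]:A[\sigma]$; $\Theta\vdash_{eq}A$ and $\Delta\vdash\sigma:\Theta$ give $\Delta\vdash\mathrm{coh}_{\Theta,A}[\sigma]:A[\sigma]$. $\mathsf{MCaTT}$ raw syntax: types $\mathbf 1$ and $\mathrm{Hom}_Atu$; terms: variables, $()$, $\mathrm{mop}_{\Theta,A}[\sigma]$, $\mathrm{mcoh}_{\Theta,A}[\sigma]$;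 every term of type $\mathbf 1$ is definitionally equal to $()$, and normal forms rewrite every such term to $()$. Desuspension $\Downarrow$: $\Downarrow\varnothing=\varnothing$, $\Downarrow(\Gamma,x:A)=(\Downarrow\Gamma,x:\Downarrow A)$, $\Downarrow\star=\mathbf 1$, $\Downarrow\mathrm{Hom}_Atu=\mathrm{Hom}_{\Downarrow A}\Downarrow t\Downarrow u$, $\Downarrow x=x$, $\Downarrow\mathrm{op}_{\Theta,A}[\sigma]=\mathrm{mop}_{\Theta,A}[\Downarrow\sigma]$, $\Downarrow\mathrm{coh}_{\Theta,A}[\sigma]=\mathrm{mcoh}_{\Theta,A}[\Downarrow\sigma]$, $\Downarrow\langle\rangle=\langle\rangle$, $\Downarrow\langle\sigma,x\mapsto t\rangle=\langle\Downarrow\sigma,x\mapsto\Downarrow t\rangle$. Reduced suspension $S$ (on $\mathsf{MCaTT}$ expressions in normal form). Fix a fresh variable $\bullet$: $S\varnothing=(\bullet:\star)$; $S(\Gamma,x:\mathbf 1)=S\Gamma$; $S(\Gamma,x:A)=(S\Gamma,x:SA)$ for $A\ne\mathbf 1$; $S\mathbf 1=\star$; $S\mathrm{Hom}_Atu=\mathrm{Hom}_{SA}St\,Su$; $S()=\bullet$; $Sx=x$ for a variable of type $\neq\mathbf 1$; $S\mathrm{mop}_{\Theta,A}[\sigma]=\mathrm{op}_{\Theta,A}[\rho_\Theta\circ S\sigma]$, $S\mathrm{mcoh}_{\Theta,A}[\sigma]=\mathrm{coh}_{\Theta,A}[\rho_\Theta\circ S\sigma]$; $S\langle\rangle=\langle\bullet\mapsto\bullet\rangle$;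 $S\langle\sigma,x\mapsto t\rangle=S\sigma$ if $x$ has type $\mathbf 1$ and $\langle S\sigma,x\mapsto St\rangle$ otherwise. For a $\mathsf{CaTT}$ context $\Theta$: $\rho_\varnothing=\langle\rangle$, $\rho_{(\Theta,x:A)}=\langle\rho_\Theta,x\mapsto S(\Downarrow x)\rangle$ (this is $\bullet$ if $A=\star$ and $x$ otherwise). -}

module Defs where

open import Data.Nat using (ℕ; zero; suc; _⊔_; _∸_; _≡ᵇ_; _<ᵇ_)
open import Data.Bool using (Bool; true; false; if_then_else_)
open import Data.List using (List; []; _∷_; _++_)
open import Data.List.Membership.Propositional using (_∈_; _∉_)
open import Data.Maybe using (Maybe; just; nothing)
open import Data.Product using (_×_; _,_)
open import Function.Bundles using (_⇔_)
open import Relation.Binary.PropositionalEquality using (_≡_; refl)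
open import Relation.Nullary using (¬_)

-- Raw syntax of CaTT.  Variables are names (natural numbers).
-- Contexts and substitutions are snoc-lists.

infixl 5 _▸_∶_
infixl 5 _▹_↦_

mutual
  data Ty : Set where
    ⋆   : Ty
    Hom : Ty → Tm → Tm → Ty

  data Tm : Set where
    var : ℕ → Tm
    op  : Ctx → Ty → Sub → Tm
    coh : Ctx → Ty → Sub → Tm

  data Ctx : Set where
    ∅     : Ctx
    _▸_∶_ : Ctx → ℕ → Ty → Ctx

  data Sub : Set where
    ⟨⟩    : Sub
    _▹_↦_ : Sub → ℕ → Tm → Sub

lookupVar : ℕ → Sub → Tm
lookupVar x ⟨⟩ = var x
lookupVar x (σ ▹ y ↦ t) = if x ≡ᵇ y then t else lookupVar x σ

mutual
  _[_]ty : Ty → Sub → Ty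
  ⋆ [ σ ]ty = ⋆
  Hom A t u [ σ ]ty = Hom (A [ σ ]ty) (t [ σ ]tm) (u [ σ ]tm)

  _[_]tm : Tm → Sub → Tm
  var x [ σ ]tm = lookupVar x σ
  op Θ A τ [ σ ]tm = op Θ A (τ ∘ σ)
  coh Θ A τ [ σ ]tm = coh Θ A (τ ∘ σ)

  _∘_ : Sub → Sub → Sub
  ⟨⟩ ∘ δ = ⟨⟩
  (σ ▹ x ↦ t) ∘ δ = (σ ∘ δ) ▹ x ↦ (t [ δ ]tm)

mutual
  VarTy : Ty → List ℕ
  VarTy ⋆ = []
  VarTy (Hom A t u) = VarTy A ++ VarTm t ++ VarTm u

  VarTm : Tm → List ℕ
  VarTm (var x) = x ∷ []
  VarTm (op Θ A σ) = VarSub σ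
  VarTm (coh Θ A σ) = VarSub σ

  VarSub : Sub → List ℕ
  VarSub ⟨⟩ = []
  VarSub (σ ▹ x ↦ t) = VarSub σ ++ VarTm t

VarCtx : Ctx → List ℕ
VarCtx ∅ = []
VarCtx (Γ ▸ x ∶ A) = VarCtx Γ ++ x ∷ []

_≈ˢ_ : List ℕ → List ℕ → Set
xs ≈ˢ ys = (z : ℕ) → (z ∈ xs) ⇔ (z ∈ ys)

mutual
  NamesTy : Ty → List ℕ
  NamesTy ⋆ = []
  NamesTy (Hom A t u) = NamesTy A ++ NamesTm t ++ NamesTm u

  NamesTm : Tm → List ℕ
  NamesTm (var x) = x ∷ []
  NamesTm (op Θ A σ) = NamesCtx Θ ++ NamesTy A ++ NamesSub σ
  NamesTm (coh Θ A σ) = NamesCtx Θ ++ NamesTy A ++ NamesSub σ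

  NamesCtx : Ctx → List ℕ
  NamesCtx ∅ = []
  NamesCtx (Γ ▸ x ∶ A) = NamesCtx Γ ++ x ∷ NamesTy A

  NamesSub : Sub → List ℕ
  NamesSub ⟨⟩ = []
  NamesSub (σ ▹ x ↦ t) = NamesSub σ ++ x ∷ NamesTm t

dimTy : Ty → ℕ
dimTy ⋆ = 0
dimTy (Hom A t u) = suc (dimTy A)

dimCtx : Ctx → ℕ
dimCtx ∅ = 0
dimCtx (Γ ▸ x ∶ A) = dimCtx Γ ⊔ dimTy A

data _∶_∈ᶜ_ : ℕ → Ty → Ctx → Set where
  here  : ∀ {Γ x A} → x ∶ A ∈ᶜ (Γ ▸ x ∶ A)
  there : ∀ {Γ x A y B} → x ∶ A ∈ᶜ Γ → x ∶ A ∈ᶜ (Γ ▸ y ∶ B)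

-- Ps-contexts (raw contexts have distinct variables, whence the
-- freshness side conditions)

data _⊢ps_∶_ : Ctx → ℕ → Ty → Set where
  pss : ∀ {x} → (∅ ▸ x ∶ ⋆) ⊢ps x ∶ ⋆
  psd : ∀ {Γ f A x y} → Γ ⊢ps f ∶ Hom A (var x) (var y) → Γ ⊢ps y ∶ A
  pse : ∀ {Γ x A y f} → Γ ⊢ps x ∶ A →
        y ∉ VarCtx Γ → f ∉ VarCtx Γ → ¬ (y ≡ f) →
        (Γ ▸ y ∶ A ▸ f ∶ Hom A (var x) (var y)) ⊢ps f ∶ Hom A (var x) (var y)

data _⊢ps : Ctx → Set where
  psdone : ∀ {Γ x} → Γ ⊢ps x ∶ ⋆ → Γ ⊢ps

dropLast : Ctx → Ctx
dropLast ∅ = ∅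
dropLast (Γ ▸ x ∶ A) = Γ

∂⁻ : ℕ → Ctx → Ctx
∂⁻ i ∅ = ∅
∂⁻ i (∅ ▸ x ∶ A) = ∅ ▸ x ∶ A
∂⁻ i (Γ ▸ y ∶ A ▸ f ∶ B) =
  if i <ᵇ suc (dimTy A)           -- dim A ≥ i
  then ∂⁻ i Γ
  else (∂⁻ i Γ ▸ y ∶ A ▸ f ∶ B)

∂⁺ : ℕ → Ctx → Ctx
∂⁺ i ∅ = ∅
∂⁺ i (∅ ▸ x ∶ A) = ∅ ▸ x ∶ A
∂⁺ i (Γ ▸ y ∶ A ▸ f ∶ B) =
  if i <ᵇ dimTy A
  then ∂⁺ i Γ
  else (if dimTy A ≡ᵇ i
        then (dropLast (∂⁺ i Γ) ▸ y ∶ A)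
        else (∂⁺ i Γ ▸ y ∶ A ▸ f ∶ B))

∂ˢ : Ctx → Ctx
∂ˢ Γ = ∂⁻ (dimCtx Γ ∸ 1) Γ

∂ᵗ : Ctx → Ctx
∂ᵗ Γ = ∂⁺ (dimCtx Γ ∸ 1) Γ

infix 4 _⊢ _⊢ty_ _⊢_∶_ _⊢s_∶_ _⊢op_ _⊢eq_

mutual
  data _⊢ : Ctx → Set where
    c-∅ : ∅ ⊢
    c-▸ : ∀ {Γ x A} → Γ ⊢ty A → x ∉ VarCtx Γ → (Γ ▸ x ∶ A) ⊢

  data _⊢ty_ : Ctx → Ty → Set where
    ty-⋆   : ∀ {Γ} → Γ ⊢ → Γ ⊢ty ⋆
    ty-Hom : ∀ {Γ A t u} → Γ ⊢ t ∶ A → Γ ⊢ u ∶ A → Γ ⊢ty Hom A t u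

  data _⊢_∶_ : Ctx → Tm → Ty → Set where
    tm-var : ∀ {Γ x A} → Γ ⊢ → x ∶ A ∈ᶜ Γ → Γ ⊢ var x ∶ A
    tm-op  : ∀ {Δ Θ A σ} → Θ ⊢op A → Δ ⊢s σ ∶ Θ → Δ ⊢ op Θ A σ ∶ (A [ σ ]ty)
    tm-coh : ∀ {Δ Θ A σ} → Θ ⊢eq A → Δ ⊢s σ ∶ Θ → Δ ⊢ coh Θ A σ ∶ (A [ σ ]ty)

  data _⊢s_∶_ : Ctx → Sub → Ctx → Set where
    s-⟨⟩ : ∀ {Δ} → Δ ⊢ → Δ ⊢s ⟨⟩ ∶ ∅
    s-▹  : ∀ {Δ σ Γ x A t} → Δ ⊢s σ ∶ Γ → (Γ ▸ x ∶ A) ⊢ → Δ ⊢ t ∶ (A [ σ ]ty) →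
           Δ ⊢s (σ ▹ x ↦ t) ∶ (Γ ▸ x ∶ A)

  data _⊢op_ : Ctx → Ty → Set where
    opr : ∀ {Γ A t u} → Γ ⊢ps → ∂ˢ Γ ⊢ t ∶ A → ∂ᵗ Γ ⊢ u ∶ A →
          (VarTm t ++ VarTy A) ≈ˢ VarCtx (∂ˢ Γ) →
          (VarTm u ++ VarTy A) ≈ˢ VarCtx (∂ᵗ Γ) →
          Γ ⊢op Hom A t u

  data _⊢eq_ : Ctx → Ty → Set where
    eqr : ∀ {Γ A t u} → Γ ⊢ps → Γ ⊢ t ∶ A → Γ ⊢ u ∶ A →
          (VarTm t ++ VarTy A) ≈ˢ VarCtx Γ →
          (VarTm u ++ VarTy A) ≈ˢ VarCtx Γ →
          Γ ⊢eq Hom A t u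

mutual
  data MTy : Set where
    𝟏    : MTy
    mHom : MTy → MTm → MTm → MTy

  data MTm : Set where
    mvar : ℕ → MTm
    unit : MTm
    mop  : Ctx → Ty → MSub → MTm
    mcoh : Ctx → Ty → MSub → MTm

  data MCtx : Set where
    m∅     : MCtx
    _m▸_∶_ : MCtx → ℕ → MTy → MCtx

  data MSub : Set where
    m⟨⟩    : MSub
    _m▹_↦_ : MSub → ℕ → MTm → MSub

⇓ty : Ty → MTy
⇓tm : Tm → MTm
⇓sub : Sub → MSub
⇓ty ⋆ = 𝟏
⇓ty (Hom A t u) = mHom (⇓ty A) (⇓tm t) (⇓tm u)
⇓tm (var x) = mvar x
⇓tm (op Θ A σ) = mop Θ A (⇓sub σ)
⇓tm (coh Θ A σ) = mcoh Θ A (⇓sub σ)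
⇓sub ⟨⟩ = m⟨⟩
⇓sub (σ ▹ x ↦ t) = ⇓sub σ m▹ x ↦ ⇓tm t

⇓ctx : Ctx → MCtx
⇓ctx ∅ = m∅
⇓ctx (Γ ▸ x ∶ A) = ⇓ctx Γ m▸ x ∶ ⇓ty A

-- Normal forms: every term of type 𝟏 is rewritten to ().
-- The type of a variable is read off the ambient context; the type of
-- mop/mcoh_{Θ,A}[σ] is (⇓A)[σ], which is 𝟏 exactly when A = ⋆.
mlookup : ℕ → MCtx → Maybe MTy
mlookup x m∅ = nothing
mlookup x (Δ m▸ y ∶ A) = if x ≡ᵇ y then just A else mlookup x Δ

isOne : Maybe MTy → Bool
isOne (just 𝟏) = true
isOne _ = false

isStar : Ty → Bool
isStar ⋆ = true
isStar (Hom _ _ _) = false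

nfTy : MCtx → MTy → MTy
nfTm : MCtx → MTm → MTm
nfSub : MCtx → MSub → MSub
nfTy Δ 𝟏 = 𝟏
nfTy Δ (mHom A t u) = mHom (nfTy Δ A) (nfTm Δ t) (nfTm Δ u)
nfTm Δ (mvar x) = if isOne (mlookup x Δ) then unit else mvar x
nfTm Δ unit = unit
nfTm Δ (mop Θ A σ) = if isStar A then unit else mop Θ A (nfSub Δ σ)
nfTm Δ (mcoh Θ A σ) = if isStar A then unit else mcoh Θ A (nfSub Δ σ)
nfSub Δ m⟨⟩ = m⟨⟩
nfSub Δ (σ m▹ x ↦ t) = nfSub Δ σ m▹ x ↦ nfTm Δ t

nfCtx : MCtx → MCtx
nfCtx m∅ = m∅
nfCtx (Δ m▸ x ∶ A) = nfCtx Δ m▸ x ∶ nfTy Δ A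

-- Reduced suspension S, with respect to a fixed name b playing the role of •

-- ρ_Θ, with the component S(⇓x) computed as in the paper's parenthetical
-- (• if A = ⋆, x otherwise); see ρ-spec below for agreement with S ∘ nf ∘ ⇓.
ρ : ℕ → Ctx → Sub
ρ b ∅ = ⟨⟩
ρ b (Θ ▸ x ∶ A) = ρ b Θ ▹ x ↦ (if isStar A then var b else var x)

STy : ℕ → MTy → Ty
STm : ℕ → MTm → Tm
SSub : ℕ → Ctx → MSub → Sub      -- the Ctx is Θ, where the substitution has target ⇓Θ
STy b 𝟏 = ⋆
STy b (mHom A t u) = Hom (STy b A) (STm b t) (STm b u)
STm b (mvar x) = var x
STm b unit = var b
STm b (mop Θ A σ) = op Θ A (ρ b Θ ∘ SSub b Θ σ)
STm b (mcoh Θ A σ) = coh Θ A (ρ b Θ ∘ SSub b Θ σ)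
SSub b Θ m⟨⟩ = ⟨⟩ ▹ b ↦ var b
SSub b Θ (σ m▹ x ↦ t) =
  if isOne (mlookup x (⇓ctx Θ)) then SSub b Θ σ else (SSub b Θ σ ▹ x ↦ STm b t)

SCtx : ℕ → MCtx → Ctx
SCtx b m∅ = ∅ ▸ b ∶ ⋆
SCtx b (Δ m▸ x ∶ 𝟏) = SCtx b Δ
SCtx b (Δ m▸ x ∶ mHom A t u) = SCtx b Δ ▸ x ∶ STy b (mHom A t u)

private
  ≡ᵇ-refl : ∀ n → (n ≡ᵇ n) ≡ true
  ≡ᵇ-refl zero = refl
  ≡ᵇ-refl (suc n) = ≡ᵇ-refl n

ρ-spec : ∀ b Θ x A →
  ρ b (Θ ▸ x ∶ A) ≡ (ρ b Θ ▹ x ↦ STm b (nfTm (⇓ctx (Θ ▸ x ∶ A)) (mvar x)))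
ρ-spec b Θ x ⋆ rewrite ≡ᵇ-refl x = refl
ρ-spec b Θ x (Hom A t u) rewrite ≡ᵇ-refl x = refl

{-# OPTIONS --safe #-}
module Submission where

-- Extending Γ by a variable of type ⋆ leaves S(⇓Γ) unchanged, and ρ
-- sends the variable to •, of type ⋆. Extending by x : A with A = Hom B t u adds
-- x : S(nf ⇓A) to S(⇓Γ), so one needs S(⇓Γ) ⊢ A[ρ_Γ], which is the substitution lemma,
-- and the syntactic identity A[ρ_Γ] = S(nf ⇓A). The identity t[ρ_Γ] = S(nf ⇓t) holds for
-- every well-typed t, by mutual induction with τ ∘ ρ_Γ = ρ_Θ ∘ S(nf ⇓τ) for the
-- substitutions Γ ⊢ τ : Θ inside op and coh: both sides send the variables of type ⋆ to •
-- (a term of type ⋆ is a variable of type ⋆) and agree on the others. Freshness of • keeps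
-- it out of the domains of these substitutions and apart from the variables of Γ.

open import Defs
open import Data.Bool using (true; false; if_then_else_)
open import Data.Bool.Properties using (T-≡)
open import Data.Empty using (⊥-elim)
open import Data.List using (List; []; _∷_; _++_)
open import Data.List.Membership.Propositional using (_∈_; _∉_)
open import Data.List.Membership.Propositional.Properties using (∈-++⁺ˡ; ∈-++⁺ʳ; ∈-++⁻)
open import Data.List.Relation.Binary.Subset.Propositional using (_⊆_)
open import Data.List.Relation.Binary.Subset.Propositional.Properties
  using (⊆-trans; xs⊆xs++ys; xs⊆ys++xs)
open import Data.List.Relation.Unary.Any as Any using ()
open import Data.Maybe using (just)
open import Data.Nat using (ℕ; suc; _≡ᵇ_; _<ᵇ_; _≟_)
open import Data.Nat.Properties using (≡ᵇ⇒≡; ≡⇒≡ᵇ)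
open import Data.Product using (∃-syntax; _,_; proj₂)
open import Data.Sum as Sum using (_⊎_; inj₁; inj₂; [_,_])
open import Function.Bundles using (Equivalence)
open import Relation.Binary.PropositionalEquality
  using (_≡_; _≢_; refl; sym; trans; cong; subst; module ≡-Reasoning)
open import Relation.Nullary using (yes; no)

≡ᵇ-refl : ∀ n → (n ≡ᵇ n) ≡ true
≡ᵇ-refl n = Equivalence.to T-≡ (≡⇒≡ᵇ n n refl)

≢⇒≡ᵇ-false : ∀ {m n} → m ≢ n → (m ≡ᵇ n) ≡ false
≢⇒≡ᵇ-false {m} {n} m≢n with m ≡ᵇ n in eq
... | true  = ⊥-elim (m≢n (≡ᵇ⇒≡ m n (Equivalence.from T-≡ eq)))
... | false = refl

lookupVar-here : ∀ {x σ t} → lookupVar x (σ ▹ x ↦ t) ≡ t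
lookupVar-here {x} rewrite ≡ᵇ-refl x = refl

lookupVar-there : ∀ {x y σ t} → x ≢ y → lookupVar x (σ ▹ y ↦ t) ≡ lookupVar x σ
lookupVar-there x≢y rewrite ≢⇒≡ᵇ-false x≢y = refl

mlookup-here : ∀ {x Δ A} → mlookup x (Δ m▸ x ∶ A) ≡ just A
mlookup-here {x} rewrite ≡ᵇ-refl x = refl

mlookup-there : ∀ {x y Δ A} → x ≢ y → mlookup x (Δ m▸ y ∶ A) ≡ mlookup x Δ
mlookup-there x≢y rewrite ≢⇒≡ᵇ-false x≢y = refl

cong-Hom : ∀ {A A′ t t′ u u′} → A ≡ A′ → t ≡ t′ → u ≡ u′ → Hom A t u ≡ Hom A′ t′ u′
cong-Hom refl refl refl = refl

cong-▹ : ∀ {σ σ′ x t t′} → σ ≡ σ′ → t ≡ t′ → (σ ▹ x ↦ t) ≡ (σ′ ▹ x ↦ t′)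
cong-▹ refl refl = refl

++-⊆ : ∀ {xs ys zs : List ℕ} → xs ⊆ zs → ys ⊆ zs → xs ++ ys ⊆ zs
++-⊆ {xs} xs⊆zs ys⊆zs p with ∈-++⁻ xs p
... | inj₁ q = xs⊆zs q
... | inj₂ q = ys⊆zs q

⊆-++⁻ˡ : ∀ (xs : List ℕ) {ys zs} → xs ++ ys ⊆ zs → xs ⊆ zs
⊆-++⁻ˡ xs h p = h (∈-++⁺ˡ p)

⊆-++⁻ʳ : ∀ (xs : List ℕ) {ys zs} → xs ++ ys ⊆ zs → ys ⊆ zs
⊆-++⁻ʳ xs h p = h (∈-++⁺ʳ xs p)

∉-++⁻ˡ : ∀ {x : ℕ} xs {ys} → x ∉ xs ++ ys → x ∉ xs
∉-++⁻ˡ xs x∉ p = x∉ (∈-++⁺ˡ p)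

∉-++⁻ʳ : ∀ {x : ℕ} xs {ys} → x ∉ xs ++ ys → x ∉ ys
∉-++⁻ʳ xs x∉ p = x∉ (∈-++⁺ʳ xs p)

∈ᶜ⇒∈VarCtx : ∀ {Γ x A} → x ∶ A ∈ᶜ Γ → x ∈ VarCtx Γ
∈ᶜ⇒∈VarCtx {Γ ▸ _ ∶ _} here = ∈-++⁺ʳ (VarCtx Γ) (Any.here refl)
∈ᶜ⇒∈VarCtx (there m)       = ∈-++⁺ˡ (∈ᶜ⇒∈VarCtx m)

∈VarCtx⇒∈ᶜ : ∀ {Γ x} → x ∈ VarCtx Γ → ∃[ A ] x ∶ A ∈ᶜ Γ
∈VarCtx⇒∈ᶜ {∅} ()
∈VarCtx⇒∈ᶜ {Γ ▸ y ∶ A} p with ∈-++⁻ (VarCtx Γ) p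
... | inj₁ q with B , m ← ∈VarCtx⇒∈ᶜ q = B , there m
... | inj₂ (Any.here refl) = A , here

∈ᶜ⇒≢-fresh : ∀ {Γ x y A} → x ∶ A ∈ᶜ Γ → y ∉ VarCtx Γ → x ≢ y
∈ᶜ⇒≢-fresh m y∉ refl = y∉ (∈ᶜ⇒∈VarCtx m)

_⊆ᶜ_ : Ctx → Ctx → Set
Γ ⊆ᶜ Γ′ = ∀ {x A} → x ∶ A ∈ᶜ Γ → x ∶ A ∈ᶜ Γ′

⊆ᶜ-keep : ∀ {Γ Γ′ x A} → Γ ⊆ᶜ Γ′ → (Γ ▸ x ∶ A) ⊆ᶜ (Γ′ ▸ x ∶ A)
⊆ᶜ-keep Γ⊆Γ′ here      = here
⊆ᶜ-keep Γ⊆Γ′ (there m) = there (Γ⊆Γ′ m)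

⊆ᶜ⇒VarCtx-⊆ : ∀ {Γ Γ′} → Γ ⊆ᶜ Γ′ → VarCtx Γ ⊆ VarCtx Γ′
⊆ᶜ⇒VarCtx-⊆ Γ⊆Γ′ p = ∈ᶜ⇒∈VarCtx (Γ⊆Γ′ (proj₂ (∈VarCtx⇒∈ᶜ p)))

mutual
  weaken-⊢ty : ∀ {Γ Γ′ A} → Γ ⊆ᶜ Γ′ → Γ′ ⊢ → Γ ⊢ty A → Γ′ ⊢ty A
  weaken-⊢ty Γ⊆Γ′ Γ′⊢ (ty-⋆ _)       = ty-⋆ Γ′⊢
  weaken-⊢ty Γ⊆Γ′ Γ′⊢ (ty-Hom td ud) = ty-Hom (weaken-⊢tm Γ⊆Γ′ Γ′⊢ td) (weaken-⊢tm Γ⊆Γ′ Γ′⊢ ud)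

  weaken-⊢tm : ∀ {Γ Γ′ t A} → Γ ⊆ᶜ Γ′ → Γ′ ⊢ → Γ ⊢ t ∶ A → Γ′ ⊢ t ∶ A
  weaken-⊢tm Γ⊆Γ′ Γ′⊢ (tm-var _ m)   = tm-var Γ′⊢ (Γ⊆Γ′ m)
  weaken-⊢tm Γ⊆Γ′ Γ′⊢ (tm-op o τd)   = tm-op o (weaken-⊢s Γ⊆Γ′ Γ′⊢ τd)
  weaken-⊢tm Γ⊆Γ′ Γ′⊢ (tm-coh o τd)  = tm-coh o (weaken-⊢s Γ⊆Γ′ Γ′⊢ τd)

  weaken-⊢s : ∀ {Γ Γ′ σ Θ} → Γ ⊆ᶜ Γ′ → Γ′ ⊢ → Γ ⊢s σ ∶ Θ → Γ′ ⊢s σ ∶ Θ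
  weaken-⊢s Γ⊆Γ′ Γ′⊢ (s-⟨⟩ _)        = s-⟨⟩ Γ′⊢
  weaken-⊢s Γ⊆Γ′ Γ′⊢ (s-▹ σd Θ⊢ td)  = s-▹ (weaken-⊢s Γ⊆Γ′ Γ′⊢ σd) Θ⊢ (weaken-⊢tm Γ⊆Γ′ Γ′⊢ td)

mutual
  ⊢ty⇒⊢ : ∀ {Γ A} → Γ ⊢ty A → Γ ⊢
  ⊢ty⇒⊢ (ty-⋆ Γ⊢)     = Γ⊢
  ⊢ty⇒⊢ (ty-Hom td _) = ⊢tm⇒⊢ td

  ⊢tm⇒⊢ : ∀ {Γ t A} → Γ ⊢ t ∶ A → Γ ⊢
  ⊢tm⇒⊢ (tm-var Γ⊢ _)  = Γ⊢
  ⊢tm⇒⊢ (tm-op _ τd)   = ⊢s⇒⊢ τd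
  ⊢tm⇒⊢ (tm-coh _ τd)  = ⊢s⇒⊢ τd

  ⊢s⇒⊢ : ∀ {Δ σ Θ} → Δ ⊢s σ ∶ Θ → Δ ⊢
  ⊢s⇒⊢ (s-⟨⟩ Δ⊢)     = Δ⊢
  ⊢s⇒⊢ (s-▹ σd _ _)  = ⊢s⇒⊢ σd

⊢s⇒⊢-target : ∀ {Δ σ Θ} → Δ ⊢s σ ∶ Θ → Θ ⊢
⊢s⇒⊢-target (s-⟨⟩ _)      = c-∅
⊢s⇒⊢-target (s-▹ _ Θ⊢ _)  = Θ⊢

dropLast-⊆ᶜ : ∀ Γ → dropLast Γ ⊆ᶜ Γ
dropLast-⊆ᶜ ∅ ()
dropLast-⊆ᶜ (Γ ▸ _ ∶ _) = there

∂⁻-⊆ᶜ : ∀ i Γ → ∂⁻ i Γ ⊆ᶜ Γ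
∂⁻-⊆ᶜ i ∅ ()
∂⁻-⊆ᶜ i (∅ ▸ x ∶ A) m = m
∂⁻-⊆ᶜ i (Γ ▸ y ∶ A ▸ f ∶ B) with i <ᵇ suc (dimTy A)
... | true  = λ m → there (there (∂⁻-⊆ᶜ i Γ m))
... | false = ⊆ᶜ-keep (⊆ᶜ-keep (∂⁻-⊆ᶜ i Γ))

∂⁺-⊆ᶜ : ∀ i Γ → ∂⁺ i Γ ⊆ᶜ Γ
∂⁺-⊆ᶜ i ∅ ()
∂⁺-⊆ᶜ i (∅ ▸ x ∶ A) m = m
∂⁺-⊆ᶜ i (Γ ▸ y ∶ A ▸ f ∶ B) with i <ᵇ dimTy A | dimTy A ≡ᵇ i
... | true  | _     = λ m → there (there (∂⁺-⊆ᶜ i Γ m))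
... | false | true  = λ m → there (⊆ᶜ-keep (λ m′ → ∂⁺-⊆ᶜ i Γ (dropLast-⊆ᶜ (∂⁺ i Γ) m′)) m)
... | false | false = ⊆ᶜ-keep (⊆ᶜ-keep (∂⁺-⊆ᶜ i Γ))

≈ˢ⇒⊆ : ∀ xs {ys} → xs ≈ˢ ys → xs ⊆ ys
≈ˢ⇒⊆ xs xs≈ys = Equivalence.to (xs≈ys _)

VarTy-Hom-⊆ : ∀ {A t u zs} → VarTm t ++ VarTy A ⊆ zs → VarTm u ++ VarTy A ⊆ zs →
  VarTy (Hom A t u) ⊆ zs
VarTy-Hom-⊆ {t = t} {u} t⊆ u⊆ =
  ++-⊆ (⊆-++⁻ʳ (VarTm t) t⊆) (++-⊆ (⊆-++⁻ˡ (VarTm t) t⊆) (⊆-++⁻ˡ (VarTm u) u⊆))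

VarTy-⊢op : ∀ {Θ B} → Θ ⊢op B → VarTy B ⊆ VarCtx Θ
VarTy-⊢op {Θ} (opr {A = A} {t} {u} _ _ _ src tgt) = VarTy-Hom-⊆ {A} {t} {u}
  (⊆-trans (≈ˢ⇒⊆ (VarTm t ++ VarTy A) src) (⊆ᶜ⇒VarCtx-⊆ (∂⁻-⊆ᶜ _ Θ)))
  (⊆-trans (≈ˢ⇒⊆ (VarTm u ++ VarTy A) tgt) (⊆ᶜ⇒VarCtx-⊆ (∂⁺-⊆ᶜ _ Θ)))

VarTy-⊢eq : ∀ {Θ B} → Θ ⊢eq B → VarTy B ⊆ VarCtx Θ
VarTy-⊢eq (eqr {A = A} {t} {u} _ _ _ src tgt) =
  VarTy-Hom-⊆ {A} {t} {u} (≈ˢ⇒⊆ (VarTm t ++ VarTy A) src) (≈ˢ⇒⊆ (VarTm u ++ VarTy A) tgt)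

dom : Sub → List ℕ
dom ⟨⟩            = []
dom (σ ▹ x ↦ _)  = x ∷ dom σ

dom-⊆-NamesSub : ∀ σ → dom σ ⊆ NamesSub σ
dom-⊆-NamesSub (σ ▹ x ↦ t) (Any.here refl) = ∈-++⁺ʳ (NamesSub σ) (Any.here refl)
dom-⊆-NamesSub (σ ▹ x ↦ t) (Any.there p)   = ∈-++⁺ˡ (dom-⊆-NamesSub σ p)

⊢s⇒VarCtx-⊆dom : ∀ {Δ σ Θ} → Δ ⊢s σ ∶ Θ → VarCtx Θ ⊆ dom σ
⊢s⇒VarCtx-⊆dom (s-⟨⟩ _) ()
⊢s⇒VarCtx-⊆dom (s-▹ {Γ = Θ} σd _ _) p with ∈-++⁻ (VarCtx Θ) p
... | inj₁ q               = Any.there (⊢s⇒VarCtx-⊆dom σd q)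
... | inj₂ (Any.here refl) = Any.here refl

VarTm-lookupVar : ∀ {x} σ → x ∈ dom σ → VarTm (lookupVar x σ) ⊆ VarSub σ
VarTm-lookupVar {x} (σ ▹ y ↦ t) x∈ with x ≟ y
... | yes refl rewrite lookupVar-here {x} {σ} {t} = xs⊆ys++xs (VarTm t) (VarSub σ)
... | no x≢y rewrite lookupVar-there {σ = σ} {t} x≢y =
  ⊆-trans (VarTm-lookupVar σ (Any.tail x≢y x∈)) (xs⊆xs++ys (VarSub σ) (VarTm t))

mutual
  VarTy-[] : ∀ A {σ} → VarTy A ⊆ dom σ → VarTy (A [ σ ]ty) ⊆ VarSub σ
  VarTy-[] ⋆           _ ()
  VarTy-[] (Hom A t u) h = ++-⊆ (VarTy-[] A (⊆-++⁻ˡ (VarTy A) h))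
    (++-⊆ (VarTm-[] t (⊆-++⁻ˡ (VarTm t) (⊆-++⁻ʳ (VarTy A) h)))
          (VarTm-[] u (⊆-++⁻ʳ (VarTm t) (⊆-++⁻ʳ (VarTy A) h))))

  VarTm-[] : ∀ t {σ} → VarTm t ⊆ dom σ → VarTm (t [ σ ]tm) ⊆ VarSub σ
  VarTm-[] (var x)     {σ} h = VarTm-lookupVar σ (h (Any.here refl))
  VarTm-[] (op _ _ τ)      h = VarSub-∘ τ h
  VarTm-[] (coh _ _ τ)     h = VarSub-∘ τ h

  VarSub-∘ : ∀ τ {σ} → VarSub τ ⊆ dom σ → VarSub (τ ∘ σ) ⊆ VarSub σ
  VarSub-∘ ⟨⟩          _ ()
  VarSub-∘ (τ ▹ x ↦ t) h =
    ++-⊆ (VarSub-∘ τ (⊆-++⁻ˡ (VarSub τ) h)) (VarTm-[] t (⊆-++⁻ʳ (VarSub τ) h))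

Scoped : Ctx → Set
Scoped Γ = ∀ {x A} → x ∶ A ∈ᶜ Γ → VarTy A ⊆ VarCtx Γ

module ScopedVars {Γ : Ctx} (scoped : Scoped Γ) where
  mutual
    VarTy-⊢ty : ∀ {A} → Γ ⊢ty A → VarTy A ⊆ VarCtx Γ
    VarTy-⊢ty (ty-⋆ _) ()
    VarTy-⊢ty (ty-Hom td ud) = ++-⊆ (VarTy-⊢tm td) (++-⊆ (VarTm-⊢tm td) (VarTm-⊢tm ud))

    VarTm-⊢tm : ∀ {t A} → Γ ⊢ t ∶ A → VarTm t ⊆ VarCtx Γ
    VarTm-⊢tm (tm-var _ m) (Any.here refl) = ∈ᶜ⇒∈VarCtx m
    VarTm-⊢tm (tm-op _ τd)  = VarSub-⊢s τd
    VarTm-⊢tm (tm-coh _ τd) = VarSub-⊢s τd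

    VarTy-⊢tm : ∀ {t A} → Γ ⊢ t ∶ A → VarTy A ⊆ VarCtx Γ
    VarTy-⊢tm (tm-var _ m) = scoped m
    VarTy-⊢tm (tm-op {A = B} o τd) =
      ⊆-trans (VarTy-[] B (⊆-trans (VarTy-⊢op o) (⊢s⇒VarCtx-⊆dom τd))) (VarSub-⊢s τd)
    VarTy-⊢tm (tm-coh {A = B} o τd) =
      ⊆-trans (VarTy-[] B (⊆-trans (VarTy-⊢eq o) (⊢s⇒VarCtx-⊆dom τd))) (VarSub-⊢s τd)

    VarSub-⊢s : ∀ {σ Θ} → Γ ⊢s σ ∶ Θ → VarSub σ ⊆ VarCtx Γ
    VarSub-⊢s (s-⟨⟩ _) ()
    VarSub-⊢s (s-▹ σd _ td) = ++-⊆ (VarSub-⊢s σd) (VarTm-⊢tm td)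

⊢⇒Scoped : ∀ Γ → Γ ⊢ → Scoped Γ
⊢⇒Scoped (Γ ▸ x ∶ A) (c-▸ Ad _) here =
  ⊆-trans (ScopedVars.VarTy-⊢ty (⊢⇒Scoped Γ (⊢ty⇒⊢ Ad)) Ad) (xs⊆xs++ys _ _)
⊢⇒Scoped (Γ ▸ x ∶ A) (c-▸ Ad _) (there m) =
  ⊆-trans (⊢⇒Scoped Γ (⊢ty⇒⊢ Ad) m) (xs⊆xs++ys _ _)

VarTy-⊢ty : ∀ {Γ A} → Γ ⊢ty A → VarTy A ⊆ VarCtx Γ
VarTy-⊢ty Ad = ScopedVars.VarTy-⊢ty (⊢⇒Scoped _ (⊢ty⇒⊢ Ad)) Ad

lookupVar-∘ : ∀ {x} τ σ → x ∈ dom τ → lookupVar x τ [ σ ]tm ≡ lookupVar x (τ ∘ σ)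
lookupVar-∘ {x} (τ ▹ y ↦ t) σ x∈ with x ≟ y
... | yes refl = trans (cong (_[ σ ]tm) (lookupVar-here {x} {τ})) (sym (lookupVar-here {x} {τ ∘ σ}))
... | no x≢y   = trans (cong (_[ σ ]tm) (lookupVar-there {σ = τ} x≢y))
                   (trans (lookupVar-∘ τ σ (Any.tail x≢y x∈)) (sym (lookupVar-there {σ = τ ∘ σ} x≢y)))

mutual
  []ty-∘ : ∀ A {τ} σ → VarTy A ⊆ dom τ → A [ τ ]ty [ σ ]ty ≡ A [ τ ∘ σ ]ty
  []ty-∘ ⋆           σ _ = refl
  []ty-∘ (Hom A t u) σ h = cong-Hom ([]ty-∘ A σ (⊆-++⁻ˡ (VarTy A) h))
    ([]tm-∘ t σ (⊆-++⁻ˡ (VarTm t) (⊆-++⁻ʳ (VarTy A) h)))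
    ([]tm-∘ u σ (⊆-++⁻ʳ (VarTm t) (⊆-++⁻ʳ (VarTy A) h)))

  []tm-∘ : ∀ t {τ} σ → VarTm t ⊆ dom τ → t [ τ ]tm [ σ ]tm ≡ t [ τ ∘ σ ]tm
  []tm-∘ (var x)     {τ} σ h = lookupVar-∘ τ σ (h (Any.here refl))
  []tm-∘ (op Θ A ν)      σ h = cong (op Θ A) (∘-assoc ν σ h)
  []tm-∘ (coh Θ A ν)     σ h = cong (coh Θ A) (∘-assoc ν σ h)

  ∘-assoc : ∀ ν {τ} σ → VarSub ν ⊆ dom τ → (ν ∘ τ) ∘ σ ≡ ν ∘ (τ ∘ σ)
  ∘-assoc ⟨⟩          σ _ = refl
  ∘-assoc (ν ▹ x ↦ t) σ h =
    cong-▹ (∘-assoc ν σ (⊆-++⁻ˡ (VarSub ν) h)) ([]tm-∘ t σ (⊆-++⁻ʳ (VarSub ν) h))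

mutual
  []ty-fresh : ∀ A {σ y s} → y ∉ VarTy A → A [ σ ▹ y ↦ s ]ty ≡ A [ σ ]ty
  []ty-fresh ⋆           _  = refl
  []ty-fresh (Hom A t u) y∉ = cong-Hom ([]ty-fresh A (∉-++⁻ˡ (VarTy A) y∉))
    ([]tm-fresh t (∉-++⁻ˡ (VarTm t) (∉-++⁻ʳ (VarTy A) y∉)))
    ([]tm-fresh u (∉-++⁻ʳ (VarTm t) (∉-++⁻ʳ (VarTy A) y∉)))

  []tm-fresh : ∀ t {σ y s} → y ∉ VarTm t → t [ σ ▹ y ↦ s ]tm ≡ t [ σ ]tm
  []tm-fresh (var x) {σ} y∉ = lookupVar-there {σ = σ} (λ x≡y → y∉ (Any.here (sym x≡y)))
  []tm-fresh (op Θ A ν)  y∉ = cong (op Θ A) (∘-fresh ν y∉)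
  []tm-fresh (coh Θ A ν) y∉ = cong (coh Θ A) (∘-fresh ν y∉)

  ∘-fresh : ∀ ν {σ y s} → y ∉ VarSub ν → ν ∘ (σ ▹ y ↦ s) ≡ ν ∘ σ
  ∘-fresh ⟨⟩          _  = refl
  ∘-fresh (ν ▹ x ↦ t) y∉ =
    cong-▹ (∘-fresh ν (∉-++⁻ˡ (VarSub ν) y∉)) ([]tm-fresh t (∉-++⁻ʳ (VarSub ν) y∉))

lookupVar-⊢ : ∀ {Δ σ Γ x A} → Δ ⊢s σ ∶ Γ → x ∶ A ∈ᶜ Γ → Δ ⊢ lookupVar x σ ∶ A [ σ ]ty
lookupVar-⊢ (s-▹ {σ = σ} {x = x} {A} {t} _ (c-▸ Ad x∉) td) here
  rewrite lookupVar-here {x} {σ} {t} | []ty-fresh A {σ} {x} {t} (λ p → x∉ (VarTy-⊢ty Ad p)) = td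
lookupVar-⊢ (s-▹ {σ = σ} {Γ} {y} {t = t} σd (c-▸ Ad y∉) _) (there {A = A} m)
  rewrite lookupVar-there {σ = σ} {t} (∈ᶜ⇒≢-fresh m y∉)
        | []ty-fresh A {σ} {y} {t} (λ p → y∉ (⊢⇒Scoped Γ (⊢ty⇒⊢ Ad) m p)) = lookupVar-⊢ σd m

mutual
  []-⊢ty : ∀ {Δ σ Γ A} → Γ ⊢ty A → Δ ⊢s σ ∶ Γ → Δ ⊢ty A [ σ ]ty
  []-⊢ty (ty-⋆ _)       σd = ty-⋆ (⊢s⇒⊢ σd)
  []-⊢ty (ty-Hom td ud) σd = ty-Hom ([]-⊢tm td σd) ([]-⊢tm ud σd)

  []-⊢tm : ∀ {Δ σ Γ t A} → Γ ⊢ t ∶ A → Δ ⊢s σ ∶ Γ → Δ ⊢ t [ σ ]tm ∶ A [ σ ]ty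
  []-⊢tm (tm-var _ m) σd = lookupVar-⊢ σd m
  []-⊢tm {Δ} {σ} (tm-op {Θ = Θ} {B} {τ} o τd) σd =
    subst (Δ ⊢ op Θ B (τ ∘ σ) ∶_) (sym ([]ty-∘ B σ (⊆-trans (VarTy-⊢op o) (⊢s⇒VarCtx-⊆dom τd))))
      (tm-op o (∘-⊢s τd σd))
  []-⊢tm {Δ} {σ} (tm-coh {Θ = Θ} {B} {τ} o τd) σd =
    subst (Δ ⊢ coh Θ B (τ ∘ σ) ∶_) (sym ([]ty-∘ B σ (⊆-trans (VarTy-⊢eq o) (⊢s⇒VarCtx-⊆dom τd))))
      (tm-coh o (∘-⊢s τd σd))

  ∘-⊢s : ∀ {Δ σ Γ τ Θ} → Γ ⊢s τ ∶ Θ → Δ ⊢s σ ∶ Γ → Δ ⊢s τ ∘ σ ∶ Θ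
  ∘-⊢s (s-⟨⟩ _) σd = s-⟨⟩ (⊢s⇒⊢ σd)
  ∘-⊢s {σ = σ} (s-▹ {A = A} τd Θ▸⊢@(c-▸ Ad _) td) σd =
    s-▹ (∘-⊢s τd σd) Θ▸⊢
      (subst (_ ⊢ _ ∶_) ([]ty-∘ A σ (⊆-trans (VarTy-⊢ty Ad) (⊢s⇒VarCtx-⊆dom τd))) ([]-⊢tm td σd))

∈ᶜ⇒⊢ty : ∀ Γ → Γ ⊢ → ∀ {x A} → x ∶ A ∈ᶜ Γ → Γ ⊢ty A
∈ᶜ⇒⊢ty (Γ ▸ x ∶ A) Γ▸⊢@(c-▸ Ad _) here      = weaken-⊢ty there Γ▸⊢ Ad
∈ᶜ⇒⊢ty (Γ ▸ x ∶ A) Γ▸⊢@(c-▸ Ad _) (there m) = weaken-⊢ty there Γ▸⊢ (∈ᶜ⇒⊢ty Γ (⊢ty⇒⊢ Ad) m)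

validity : ∀ {Γ t A} → Γ ⊢ t ∶ A → Γ ⊢ty A
validity (tm-var Γ⊢ m) = ∈ᶜ⇒⊢ty _ Γ⊢ m
validity (tm-op {Θ = Θ} (opr _ sd ud _ _) τd) =
  []-⊢ty (ty-Hom (weaken-⊢tm (∂⁻-⊆ᶜ _ Θ) Θ⊢ sd) (weaken-⊢tm (∂⁺-⊆ᶜ _ Θ) Θ⊢ ud)) τd
  where
  Θ⊢ : Θ ⊢
  Θ⊢ = ⊢s⇒⊢-target τd
validity (tm-coh (eqr _ sd ud _ _) τd) = []-⊢ty (ty-Hom sd ud) τd

isOne-⇓ty : ∀ A → isOne (just (⇓ty A)) ≡ isStar A
isOne-⇓ty ⋆           = refl
isOne-⇓ty (Hom _ _ _) = refl

mlookup-⇓ctx : ∀ {Γ x A} → Γ ⊢ → x ∶ A ∈ᶜ Γ → mlookup x (⇓ctx Γ) ≡ just (⇓ty A)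
mlookup-⇓ctx {Γ ▸ x ∶ A} _           here      = mlookup-here {x} {⇓ctx Γ}
mlookup-⇓ctx {Γ ▸ y ∶ B} (c-▸ Ad y∉) (there m) =
  trans (mlookup-there {Δ = ⇓ctx Γ} {⇓ty B} (∈ᶜ⇒≢-fresh m y∉)) (mlookup-⇓ctx (⊢ty⇒⊢ Ad) m)

isOne-mlookup-⇓ctx : ∀ {Γ x A} → Γ ⊢ → x ∶ A ∈ᶜ Γ → isOne (mlookup x (⇓ctx Γ)) ≡ isStar A
isOne-mlookup-⇓ctx {A = A} Γ⊢ m = trans (cong isOne (mlookup-⇓ctx Γ⊢ m)) (isOne-⇓ty A)

module _ (b : ℕ) where

  S-nf-var : ∀ {Γ x A} → Γ ⊢ → x ∶ A ∈ᶜ Γ →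
    STm b (nfTm (⇓ctx Γ) (mvar x)) ≡ (if isStar A then var b else var x)
  S-nf-var {A = ⋆}         Γ⊢ m rewrite mlookup-⇓ctx Γ⊢ m = refl
  S-nf-var {A = Hom _ _ _} Γ⊢ m rewrite mlookup-⇓ctx Γ⊢ m = refl

  lookupVar-ρ : ∀ {Γ x A} → Γ ⊢ → x ∶ A ∈ᶜ Γ →
    lookupVar x (ρ b Γ) ≡ (if isStar A then var b else var x)
  lookupVar-ρ {Γ ▸ x ∶ A} _           here      = lookupVar-here {x} {ρ b Γ}
  lookupVar-ρ {Γ ▸ y ∶ _} (c-▸ Ad y∉) (there m) =
    trans (lookupVar-there {σ = ρ b Γ} (∈ᶜ⇒≢-fresh m y∉)) (lookupVar-ρ (⊢ty⇒⊢ Ad) m)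

  ρ-[]-⋆ : ∀ {Γ t A} → Γ ⊢ t ∶ A → A ≡ ⋆ → t [ ρ b Γ ]tm ≡ var b
  ρ-[]-⋆ (tm-var Γ⊢ m)              refl = lookupVar-ρ Γ⊢ m
  ρ-[]-⋆ (tm-op (opr _ _ _ _ _) _)  ()
  ρ-[]-⋆ (tm-coh (eqr _ _ _ _ _) _) ()

  lookupVar-SSub-skip : ∀ {x y} Θ μ s → x ≢ y →
    lookupVar x (SSub b Θ (μ m▹ y ↦ s)) ≡ lookupVar x (SSub b Θ μ)
  lookupVar-SSub-skip {y = y} Θ μ s x≢y with isOne (mlookup y (⇓ctx Θ))
  ... | true  = refl
  ... | false = lookupVar-there {σ = SSub b Θ μ} x≢y

  lookupVar-SSub-keep : ∀ {x} Θ μ s → isOne (mlookup x (⇓ctx Θ)) ≡ false →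
    lookupVar x (SSub b Θ (μ m▹ x ↦ s)) ≡ STm b s
  lookupVar-SSub-keep {x} Θ μ s x-kept rewrite x-kept = lookupVar-here {x} {SSub b Θ μ}

  lookupVar-•-SSub : ∀ Θ D τ → b ∉ dom τ → lookupVar b (SSub b Θ (nfSub D (⇓sub τ))) ≡ var b
  lookupVar-•-SSub Θ D ⟨⟩          _  = lookupVar-here {b} {⟨⟩}
  lookupVar-•-SSub Θ D (τ ▹ y ↦ t) b∉ =
    trans (lookupVar-SSub-skip Θ (nfSub D (⇓sub τ)) (nfTm D (⇓tm t)) (λ b≡y → b∉ (Any.here b≡y)))
      (lookupVar-•-SSub Θ D τ (λ p → b∉ (Any.there p)))

  lookupVar-SSub : ∀ Θ D τ {x} → x ∈ dom τ → isOne (mlookup x (⇓ctx Θ)) ≡ false →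
    lookupVar x (SSub b Θ (nfSub D (⇓sub τ))) ≡ STm b (nfTm D (⇓tm (lookupVar x τ)))
  lookupVar-SSub Θ D (τ ▹ y ↦ t) {x} x∈ x-kept with x ≟ y
  ... | yes refl =
    trans (lookupVar-SSub-keep Θ (nfSub D (⇓sub τ)) (nfTm D (⇓tm t)) x-kept)
      (cong (λ s → STm b (nfTm D (⇓tm s))) (sym (lookupVar-here {x} {τ})))
  ... | no x≢y = begin
    lookupVar x (SSub b Θ (μ m▹ y ↦ nfTm D (⇓tm t))) ≡⟨ lookupVar-SSub-skip Θ μ (nfTm D (⇓tm t)) x≢y ⟩
    lookupVar x (SSub b Θ μ)                          ≡⟨ lookupVar-SSub Θ D τ (Any.tail x≢y x∈) x-kept ⟩
    S-nf-⇓ (lookupVar x τ)                            ≡⟨ cong S-nf-⇓ (sym (lookupVar-there {σ = τ} {t} x≢y)) ⟩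
    S-nf-⇓ (lookupVar x (τ ▹ y ↦ t))                  ∎
    where
    open ≡-Reasoning
    μ : MSub
    μ = nfSub D (⇓sub τ)
    S-nf-⇓ : Tm → Tm
    S-nf-⇓ s = STm b (nfTm D (⇓tm s))

  Suspends : Ctx → Sub → Ctx → Sub → Set
  Suspends Γ τ Θ X = ∀ {x A} → x ∶ A ∈ᶜ Θ → isStar A ≡ false →
    lookupVar x X ≡ STm b (nfTm (⇓ctx Γ) (⇓tm (lookupVar x τ)))

  Suspends-▹⁻ : ∀ {Γ τ Θ X x A t} → (Θ ▸ x ∶ A) ⊢ →
    Suspends Γ (τ ▹ x ↦ t) (Θ ▸ x ∶ A) X → Suspends Γ τ Θ X
  Suspends-▹⁻ {Γ} {τ} {t = t} (c-▸ _ x∉) X-susp m B≢⋆ =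
    trans (X-susp (there m) B≢⋆)
      (cong (λ s → STm b (nfTm (⇓ctx Γ) (⇓tm s))) (lookupVar-there {σ = τ} {t} (∈ᶜ⇒≢-fresh m x∉)))

  mutual
    ρ-[]tm : ∀ {Γ t A} → Γ ⊢ t ∶ A → b ∉ NamesTm t →
      t [ ρ b Γ ]tm ≡ STm b (nfTm (⇓ctx Γ) (⇓tm t))
    ρ-[]tm (tm-var Γ⊢ m) _ = trans (lookupVar-ρ Γ⊢ m) (sym (S-nf-var Γ⊢ m))
    ρ-[]tm (tm-op {Θ = Θ} (opr {A = B} {s} {u} _ _ _ _ _) τd) b∉ =
      cong (op Θ (Hom B s u)) (ρ-∘ τd (∉-++⁻ʳ (NamesTy (Hom B s u)) (∉-++⁻ʳ (NamesCtx Θ) b∉)))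
    ρ-[]tm (tm-coh {Θ = Θ} (eqr {A = B} {s} {u} _ _ _ _ _) τd) b∉ =
      cong (coh Θ (Hom B s u)) (ρ-∘ τd (∉-++⁻ʳ (NamesTy (Hom B s u)) (∉-++⁻ʳ (NamesCtx Θ) b∉)))

    ρ-∘ : ∀ {Γ τ Θ} → Γ ⊢s τ ∶ Θ → b ∉ NamesSub τ →
      τ ∘ ρ b Γ ≡ ρ b Θ ∘ SSub b Θ (nfSub (⇓ctx Γ) (⇓sub τ))
    ρ-∘ {Γ} {τ} {Θ} τd b∉ = sym (ρ-∘-Suspends τd b∉ •↦• suspends)
      where
      •↦• : lookupVar b (SSub b Θ (nfSub (⇓ctx Γ) (⇓sub τ))) ≡ var b
      •↦• = lookupVar-•-SSub Θ (⇓ctx Γ) τ (λ p → b∉ (dom-⊆-NamesSub τ p))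
      suspends : Suspends Γ τ Θ (SSub b Θ (nfSub (⇓ctx Γ) (⇓sub τ)))
      suspends m A≢⋆ = lookupVar-SSub Θ (⇓ctx Γ) τ (⊢s⇒VarCtx-⊆dom τd (∈ᶜ⇒∈VarCtx m))
        (trans (isOne-mlookup-⇓ctx (⊢s⇒⊢-target τd) m) A≢⋆)

    -- X stays fixed while the induction peels off τ, so S(nf ⇓τ) for the whole τ enters
    -- only through its values at • and at the variables not of type ⋆.
    ρ-∘-Suspends : ∀ {Γ τ Θ X} → Γ ⊢s τ ∶ Θ → b ∉ NamesSub τ → lookupVar b X ≡ var b →
      Suspends Γ τ Θ X → ρ b Θ ∘ X ≡ τ ∘ ρ b Γ
    ρ-∘-Suspends (s-⟨⟩ _) _ _ _ = refl
    ρ-∘-Suspends {τ = τ ▹ _ ↦ _} {X = X} (s-▹ {A = ⋆} τd Θ▸⊢ td) b∉ X-• X-susp =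
      cong-▹ (ρ-∘-Suspends τd (∉-++⁻ˡ (NamesSub τ) b∉) X-• (Suspends-▹⁻ {τ = τ} {X = X} Θ▸⊢ X-susp))
        (trans X-• (sym (ρ-[]-⋆ td refl)))
    ρ-∘-Suspends {Γ} {τ ▹ x ↦ t} {X = X} (s-▹ {A = Hom _ _ _} τd Θ▸⊢ td) b∉ X-• X-susp =
      cong-▹ (ρ-∘-Suspends τd (∉-++⁻ˡ (NamesSub τ) b∉) X-• (Suspends-▹⁻ {τ = τ} {X = X} Θ▸⊢ X-susp))
        (trans (X-susp here refl)
          (trans (cong (λ s → STm b (nfTm (⇓ctx Γ) (⇓tm s))) (lookupVar-here {x} {τ}))
            (sym (ρ-[]tm td (λ p → b∉ (∈-++⁺ʳ (NamesSub τ) (Any.there p)))))))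

  ρ-[]ty : ∀ {Γ} A → Γ ⊢ty A → b ∉ NamesTy A →
    A [ ρ b Γ ]ty ≡ STy b (nfTy (⇓ctx Γ) (⇓ty A))
  ρ-[]ty ⋆           _              _  = refl
  ρ-[]ty (Hom A t u) (ty-Hom td ud) b∉ = cong-Hom
    (ρ-[]ty A (validity td) (∉-++⁻ˡ (NamesTy A) b∉))
    (ρ-[]tm td (∉-++⁻ˡ (NamesTm t) (∉-++⁻ʳ (NamesTy A) b∉)))
    (ρ-[]tm ud (∉-++⁻ʳ (NamesTm t) (∉-++⁻ʳ (NamesTy A) b∉)))

  ∈-SCtx : ∀ Γ {z} → z ∈ VarCtx (SCtx b (nfCtx (⇓ctx Γ))) → z ≡ b ⊎ z ∈ VarCtx Γ
  ∈-SCtx ∅ (Any.here z≡b) = inj₁ z≡b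
  ∈-SCtx (Γ ▸ x ∶ ⋆) p = Sum.map₂ ∈-++⁺ˡ (∈-SCtx Γ p)
  ∈-SCtx (Γ ▸ x ∶ Hom A t u) p with ∈-++⁻ (VarCtx (SCtx b (nfCtx (⇓ctx Γ)))) p
  ... | inj₁ q               = Sum.map₂ ∈-++⁺ˡ (∈-SCtx Γ q)
  ... | inj₂ (Any.here refl) = inj₂ (∈-++⁺ʳ (VarCtx Γ) (Any.here refl))

  •∈SCtx : ∀ M → b ∶ ⋆ ∈ᶜ SCtx b M
  •∈SCtx m∅                    = here
  •∈SCtx (M m▸ x ∶ 𝟏)          = •∈SCtx M
  •∈SCtx (M m▸ x ∶ mHom _ _ _) = there (•∈SCtx M)

mainTheorem13 : (b : ℕ) (Γ : Ctx) → b ∉ NamesCtx Γ → Γ ⊢ →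
    SCtx b (nfCtx (⇓ctx Γ)) ⊢s ρ b Γ ∶ Γ
mainTheorem13 b ∅ _ c-∅ = s-⟨⟩ (c-▸ (ty-⋆ c-∅) λ ())
mainTheorem13 b (Γ ▸ x ∶ ⋆) b∉ Γ▸⊢@(c-▸ Ad _) =
  s-▹ ρ⊢ Γ▸⊢ (tm-var (⊢s⇒⊢ ρ⊢) (•∈SCtx b (nfCtx (⇓ctx Γ))))
  where
  ρ⊢ : SCtx b (nfCtx (⇓ctx Γ)) ⊢s ρ b Γ ∶ Γ
  ρ⊢ = mainTheorem13 b Γ (∉-++⁻ˡ (NamesCtx Γ) b∉) (⊢ty⇒⊢ Ad)
mainTheorem13 b (Γ ▸ x ∶ A@(Hom _ _ _)) b∉ Γ▸⊢@(c-▸ Ad x∉) =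
  s-▹ (weaken-⊢s there SΓ▸⊢ ρ⊢) Γ▸⊢
    (tm-var SΓ▸⊢ (subst (λ T → x ∶ T ∈ᶜ (SΓ ▸ x ∶ SA)) (sym ρA≡SA) here))
  where
  SΓ : Ctx
  SΓ = SCtx b (nfCtx (⇓ctx Γ))
  SA : Ty
  SA = STy b (nfTy (⇓ctx Γ) (⇓ty A))
  ρ⊢ : SΓ ⊢s ρ b Γ ∶ Γ
  ρ⊢ = mainTheorem13 b Γ (∉-++⁻ˡ (NamesCtx Γ) b∉) (⊢ty⇒⊢ Ad)
  ρA≡SA : A [ ρ b Γ ]ty ≡ SA
  ρA≡SA = ρ-[]ty b A Ad (λ p → b∉ (∈-++⁺ʳ (NamesCtx Γ) (Any.there p)))
  x∉SΓ : x ∉ VarCtx SΓ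
  x∉SΓ p = [ (λ x≡b → b∉ (∈-++⁺ʳ (NamesCtx Γ) (Any.here (sym x≡b)))) , x∉ ] (∈-SCtx b Γ p)
  SΓ▸⊢ : (SΓ ▸ x ∶ SA) ⊢
  SΓ▸⊢ = c-▸ (subst (SΓ ⊢ty_) ρA≡SA ([]-⊢ty Ad ρ⊢)) x∉SΓ
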